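{- Let $m,n\geq 2$, let $G=(V,E)$ be the rook's graph $K_m\square K_n$ and let $\alpha$ be an elimination ordering over $G$. For every step $i\in\{1,\dots,|V|\}$, $$\mathrm{madj}^+_\alpha(\alpha(i))=\{v_{r,c} : c\in \mathcal{L}_\alpha(i) \text{ or } r\in \mathcal{M}_\alpha(i)\}\setminus \alpha[1,i].$$
   Context: The rook's graph $K_m\square K_n$ has vertex set $\{v_{r,c}: 1\le r\le m, 1\le c\le n\}$, with $v_{r,c}\sim v_{r',c'}$ iff exactly one of $r=r'$, $c=c'$ holds. For a graph $G=(V,E)$, an elimination ordering is a bijection $\alpha:\{1,\dots,|V|\}\to V$. The elimination game: $G_0=G$, and for $i=1,\dots,|V|$, $G_i$ is obtained from $G_{i-1}$ by adding edges so that $N_{G_{i-1}}(\alpha(i))$ becomes a clique and then deleting $\alpha(i)$. Define $\mathrm{madj}^+_\alpha(\alpha(i)) := N_{G_{i-1}}(\alpha(i))$. For $i\le j$ let $\alpha[i,j]=\{\alpha(t): i\le t\le j\}$. Let $\mathrm{comp}_\alpha(i)$ be the connected component of the induced subgraph $G[\alpha[1,i]]$ (of the original graph $G$) containing $\alpha(i)$, with vertex set $V_{\mathrm{comp}_\alpha(i)}$. Let $\mathcal{M}_\alpha(i)=\{r : \exists c,\ v_{r,c}\in V_{\mathrm{comp}_\alpha(i)}\}$ (row indices spanned) and $\mathcal{L}_\alpha(i)=\{c: \exists r,\ v_{r,c}\in V_{\mathrm{comp}_\alpha(i)}\}$ (column indices spanned). -}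

module Defs where

open import Level using (0ℓ)
open import Data.Nat using (ℕ; _*_)
open import Data.Fin using (Fin; toℕ; _≤_)
open import Data.Product using (_×_; _,_; ∃; proj₁; proj₂)
open import Data.Sum using (_⊎_)
open import Data.List using (List; []; _∷_; foldl; take; map; allFin)
open import Relation.Nullary using (¬_)
open import Relation.Binary.PropositionalEquality using (_≡_; _≢_)

Vertex : ℕ → ℕ → Set
Vertex m n = Fin m × Fin n

row : ∀ {m n} → Vertex m n → Fin m
row = proj₁

col : ∀ {m n} → Vertex m n → Fin n
col = proj₂

Graph : Set → Set₁
Graph V = V → V → Set

Rook : (m n : ℕ) → Graph (Vertex m n)
Rook m n (r , c) (r' , c') = (r ≡ r' × c ≢ c') ⊎ (r ≢ r' × c ≡ c')

-- One step of the elimination game: make N(x) a clique, then delete x.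
elimStep : ∀ {V : Set} → Graph V → V → Graph V
elimStep E x u v = u ≢ x × v ≢ x × (E u v ⊎ (E x u × E x v × u ≢ v))

eliminate : ∀ {V : Set} → Graph V → List V → Graph V
eliminate = foldl elimStep

-- Steps are 0-indexed: step i ∈ Fin N corresponds to paper's step i+1.
-- The vertices eliminated strictly before step i, in order: α(0..i-1).
before : ∀ {V : Set} {N : ℕ} → (Fin N → V) → Fin N → List V
before {N = N} α i = take (toℕ i) (map α (allFin N))

-- G_{i-1} in the paper's indexing: the graph just before eliminating α(i).
gameGraph : ∀ {V : Set} {N : ℕ} → Graph V → (Fin N → V) → Fin N → Graph V
gameGraph G α i = eliminate G (before α i)

madj⁺ : ∀ {V : Set} {N : ℕ} → Graph V → (Fin N → V) → Fin N → V → Set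
madj⁺ G α i w = gameGraph G α i (α i) w

-- α[1,i] (paper) = { α(t) : t ≤ i } (0-indexed here).
prefix : ∀ {V : Set} {N : ℕ} → (Fin N → V) → Fin N → V → Set
prefix α i u = ∃ λ t → t ≤ i × α t ≡ u

-- Paths in the induced subgraph G[P]: x and y joined by a walk all of whose
-- vertices satisfy P (x itself is required to satisfy P).
data Reach {V : Set} (G : Graph V) (P : V → Set) : V → V → Set where
  here  : ∀ {x} → P x → Reach G P x x
  there : ∀ {x y z} → Reach G P x y → G y z → P z → Reach G P x z

inComp : ∀ {V : Set} {N : ℕ} → Graph V → (Fin N → V) → Fin N → V → Set
inComp G α i u = Reach G (prefix α i) (α i) u

𝓜 : ∀ {m n N} → (Fin N → Vertex m n) → Fin N → Fin m → Set
𝓜 {m} {n} α i r = ∃ λ c → inComp (Rook m n) α i (r , c)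

𝓛 : ∀ {m n N} → (Fin N → Vertex m n) → Fin N → Fin n → Set
𝓛 {m} {n} α i c = ∃ λ r → inComp (Rook m n) α i (r , c)

module Submission where

open import Defs
open import Data.Nat using (ℕ; _*_; _≥_)
open import Data.Fin using (Fin)
open import Data.Product using (_×_)
open import Data.Sum using (_⊎_)
open import Relation.Nullary using (¬_)
open import Relation.Binary.PropositionalEquality using (_≡_)
open import Function.Definitions using (Bijective)
open import Function.Bundles using (_⇔_)

open import Data.Nat using (suc; s≤s; z≤n; _<_)
open import Data.Nat.Properties using (m≤n⇒m<n∨m≡n; <-irrefl; <⇒≤; ≤-refl)
open import Data.Fin as Fin using (toℕ)
open import Data.Fin.Properties using (toℕ-injective)
open import Data.Product using (∃; _,_; proj₁)
open import Data.Product.Properties using (≡-dec)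
open import Data.Sum using (inj₁; inj₂)
open import Data.Empty using (⊥-elim)
open import Data.List using (List; []; _∷_; take; tabulate)
open import Data.List.Properties using (map-tabulate)
open import Data.List.Relation.Unary.Any using (here; there)
open import Data.List.Membership.Propositional using (_∈_; _∉_)
open import Relation.Nullary using (yes; no)
open import Relation.Binary.PropositionalEquality using (refl; sym; subst; cong; _≢_)
open import Relation.Binary.Definitions using (DecidableEquality; Symmetric; Irreflexive)
open import Function.Definitions using (Injective)
open import Function.Bundles using (mk⇔; Equivalence)
open import Function using (_∘_)

-- By the fill-path lemma of Rose, Tarjan and Lueker, after eliminating the
-- vertices of L two remaining vertices u ≠ v are adjacent iff G has a u–v walk
-- whose interior vertices all lie in L.  For u = α(i) and L = α[1,i-1], such
-- walks run inside comp_α(i) and end at a neighbour of it outside α[1,i]; in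
-- the rook's graph the vertices outside α[1,i] adjacent to comp_α(i) are
-- exactly those sharing a row or a column with it.

data FillPath {V : Set} (H : Graph V) (S : V → Set) : V → V → Set where
  edge : ∀ {u v} → H u v → FillPath H S u v
  step : ∀ {u y v} → FillPath H S u y → S y → H y v → FillPath H S u v

FillPath⁼ : {V : Set} → Graph V → (V → Set) → V → V → Set
FillPath⁼ H S u a = u ≡ a ⊎ (S a × FillPath H S u a)

fillPath⁼-extend : ∀ {V} {H : Graph V} {S u a v} →
                   FillPath⁼ H S u a → H a v → FillPath H S u v
fillPath⁼-extend (inj₁ refl)     h = edge h
fillPath⁼-extend (inj₂ (a∈ , p)) h = step p a∈ h

module Elimination {V : Set} (_≟_ : DecidableEquality V) where

  elimStep-sym : ∀ {H : Graph V} {x} → Symmetric H → Symmetric (elimStep H x)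
  elimStep-sym s (u≢x , v≢x , inj₁ h)                 = v≢x , u≢x , inj₁ (s h)
  elimStep-sym s (u≢x , v≢x , inj₂ (hxu , hxv , u≢v)) = v≢x , u≢x , inj₂ (hxv , hxu , u≢v ∘ sym)

  elimStep-irrefl : ∀ {H : Graph V} {x} → Irreflexive _≡_ H → Irreflexive _≡_ (elimStep H x)
  elimStep-irrefl irr refl (_ , _ , inj₁ h)             = irr refl h
  elimStep-irrefl irr refl (_ , _ , inj₂ (_ , _ , u≢u)) = u≢u refl

  fillPath-source-≢ : ∀ {H : Graph V} {x S u v} → FillPath (elimStep H x) S u v → u ≢ x
  fillPath-source-≢ (edge (u≢x , _ , _)) = u≢x
  fillPath-source-≢ (step p _ _)         = fillPath-source-≢ p

  fillPath-target-≢ : ∀ {H : Graph V} {x S u v} → FillPath (elimStep H x) S u v → v ≢ x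
  fillPath-target-≢ (edge (_ , v≢x , _))     = v≢x
  fillPath-target-≢ (step _ _ (_ , v≢x , _)) = v≢x

  fillPath-unelim : ∀ {H : Graph V} {x L u v} → Symmetric H →
                    FillPath (elimStep H x) (_∈ L) u v → FillPath H (_∈ x ∷ L) u v
  fillPath-unelim s (edge (_ , _ , inj₁ h))               = edge h
  fillPath-unelim s (edge (_ , _ , inj₂ (hxu , hxv , _)))  = step (edge (s hxu)) (here refl) hxv
  fillPath-unelim s (step p y∈ (_ , _ , inj₁ h))          = step (fillPath-unelim s p) (there y∈) h
  fillPath-unelim s (step p y∈ (_ , _ , inj₂ (hxy , hxv , _))) =
    step (step (fillPath-unelim s p) (there y∈) (s hxy)) (here refl) hxv

  -- Removing x from a walk: every passage a – x – b is replaced by the fill edge a – b.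
  module Shortcut (H : Graph V) (x : V) (L : List V)
                  (s : Symmetric H) (irr : Irreflexive _≡_ H) where

    H′ : Graph V
    H′ = elimStep H x

    ∈-tail : ∀ {y} → y ∈ x ∷ L → y ≢ x → y ∈ L
    ∈-tail (here y≡x) y≢x = ⊥-elim (y≢x y≡x)
    ∈-tail (there y∈) _   = y∈

    mutual
      fillPath-shortcut : ∀ {u v} → u ≢ x → v ≢ x →
                          FillPath H (_∈ x ∷ L) u v → u ≡ v ⊎ FillPath H′ (_∈ L) u v
      fillPath-shortcut u≢x v≢x (edge h) = inj₂ (edge (u≢x , v≢x , inj₁ h))
      fillPath-shortcut {v = v} u≢x v≢x (step {y = y} p y∈ h) with y ≟ x
      ... | yes refl with fillPath-into u≢x p
      ...   | a , hax , a≢x , q with a ≟ v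
      ...     | yes refl = forget q
        where forget : ∀ {u} → FillPath⁼ H′ (_∈ L) u a → u ≡ a ⊎ FillPath H′ (_∈ L) u a
              forget (inj₁ u≡a)     = inj₁ u≡a
              forget (inj₂ (_ , r)) = inj₂ r
      ...     | no a≢v = inj₂ (fillPath⁼-extend q (a≢x , v≢x , inj₂ (s hax , h , a≢v)))
      fillPath-shortcut {u} u≢x v≢x (step {y = y} p y∈ h) | no y≢x =
        inj₂ (fillPath⁼-extend (entry (fillPath-shortcut u≢x y≢x p)) (y≢x , v≢x , inj₁ h))
        where entry : u ≡ y ⊎ FillPath H′ (_∈ L) u y → FillPath⁼ H′ (_∈ L) u y
              entry (inj₁ u≡y) = inj₁ u≡y
              entry (inj₂ r)   = inj₂ (∈-tail y∈ y≢x , r)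

      fillPath-into : ∀ {u} → u ≢ x → FillPath H (_∈ x ∷ L) u x →
                      ∃ λ a → H a x × a ≢ x × FillPath⁼ H′ (_∈ L) u a
      fillPath-into {u} u≢x (edge h) = u , h , u≢x , inj₁ refl
      fillPath-into u≢x (step {y = y} p y∈ h) with y ≟ x
      ... | yes refl = ⊥-elim (irr refl h)
      ... | no y≢x with fillPath-shortcut u≢x y≢x p
      ...   | inj₁ u≡y = y , h , y≢x , inj₁ u≡y
      ...   | inj₂ r   = y , h , y≢x , inj₂ (∈-tail y∈ y≢x , r)

  eliminate-sound : ∀ {H : Graph V} → Symmetric H → Irreflexive _≡_ H → ∀ L {u v} →
                    eliminate H L u v → u ∉ L × v ∉ L × u ≢ v × FillPath H (_∈ L) u v
  eliminate-sound s irr [] h = (λ ()) , (λ ()) , (λ u≡v → irr u≡v h) , edge h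
  eliminate-sound {H} s irr (x ∷ L) h
    with eliminate-sound (elimStep-sym {H} {x} s) (elimStep-irrefl {H} {x} irr) L h
  ... | u∉ , v∉ , u≢v , p =
    (λ { (here u≡x) → fillPath-source-≢ p u≡x ; (there u∈) → u∉ u∈ }) ,
    (λ { (here v≡x) → fillPath-target-≢ p v≡x ; (there v∈) → v∉ v∈ }) ,
    u≢v , fillPath-unelim s p

  eliminate-complete : ∀ {H : Graph V} → Symmetric H → Irreflexive _≡_ H → ∀ L {u v} →
                       u ∉ L → v ∉ L → u ≢ v → FillPath H (_∈ L) u v → eliminate H L u v
  eliminate-complete s irr [] _ _ _ (edge h)     = h
  eliminate-complete s irr [] _ _ _ (step _ () _)
  eliminate-complete {H} s irr (x ∷ L) u∉ v∉ u≢v p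
    with Shortcut.fillPath-shortcut H x L s irr (u∉ ∘ here) (v∉ ∘ here) p
  ... | inj₁ u≡v = ⊥-elim (u≢v u≡v)
  ... | inj₂ p′  = eliminate-complete (elimStep-sym {H} {x} s) (elimStep-irrefl {H} {x} irr)
                                      L (u∉ ∘ there) (v∉ ∘ there) u≢v p′

∈-take-tabulate⁻ : ∀ {A : Set} {N} k (f : Fin N → A) {y} → y ∈ take k (tabulate f) →
                   ∃ λ t → toℕ t < k × f t ≡ y
∈-take-tabulate⁻ {N = suc N} (suc k) f (here y≡f0) = Fin.zero , s≤s z≤n , sym y≡f0
∈-take-tabulate⁻ {N = suc N} (suc k) f (there y∈) with ∈-take-tabulate⁻ k (f ∘ Fin.suc) y∈
... | t , t<k , ft≡y = Fin.suc t , s≤s t<k , ft≡y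

∈-take-tabulate⁺ : ∀ {A : Set} {N} k (f : Fin N → A) t → toℕ t < k → f t ∈ take k (tabulate f)
∈-take-tabulate⁺ (suc k) f Fin.zero    _         = here refl
∈-take-tabulate⁺ (suc k) f (Fin.suc t) (s≤s t<k) = there (∈-take-tabulate⁺ k (f ∘ Fin.suc) t t<k)

module _ {V : Set} {N : ℕ} (α : Fin N → V) (i : Fin N) where

  before≡take-tabulate : before α i ≡ take (toℕ i) (tabulate α)
  before≡take-tabulate = cong (take (toℕ i)) (map-tabulate (λ t → t) α)

  before⇒prefix : ∀ {y} → y ∈ before α i → prefix α i y
  before⇒prefix y∈ with ∈-take-tabulate⁻ (toℕ i) α (subst (_ ∈_) before≡take-tabulate y∈)
  ... | t , t<i , αt≡y = t , <⇒≤ t<i , αt≡y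

  prefix⇒current⊎before : ∀ {y} → prefix α i y → y ≡ α i ⊎ y ∈ before α i
  prefix⇒current⊎before (t , t≤i , refl) with m≤n⇒m<n∨m≡n t≤i
  ... | inj₁ t<i = inj₂ (subst (α t ∈_) (sym before≡take-tabulate)
                                (∈-take-tabulate⁺ (toℕ i) α t t<i))
  ... | inj₂ t≡i = inj₁ (cong α (toℕ-injective t≡i))

  current∉before : Injective _≡_ _≡_ α → α i ∉ before α i
  current∉before inj αi∈ with ∈-take-tabulate⁻ (toℕ i) α (subst (_ ∈_) before≡take-tabulate αi∈)
  ... | t , t<i , αt≡αi with inj αt≡αi
  ... | refl = <-irrefl refl t<i

  module _ (G : Graph V) where

    inComp⇒prefix : ∀ {z} → inComp G α i z → prefix α i z
    inComp⇒prefix (here pz)      = pz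
    inComp⇒prefix (there _ _ pz) = pz

    fillPath⇒componentNeighbour : ∀ {v} → FillPath G (_∈ before α i) (α i) v →
                                  ∃ λ z → inComp G α i z × G z v
    fillPath⇒componentNeighbour (edge h) = α i , here (i , ≤-refl , refl) , h
    fillPath⇒componentNeighbour (step {y = y} p y∈ h) with fillPath⇒componentNeighbour p
    ... | z , z∈ , g = y , there z∈ g (before⇒prefix y∈) , h

    componentNeighbour⇒fillPath : ∀ {z v} → inComp G α i z → G z v →
                                  FillPath G (_∈ before α i) (α i) v
    componentNeighbour⇒fillPath (here _) h = edge h
    componentNeighbour⇒fillPath (there z∈ g pz) h with prefix⇒current⊎before pz
    ... | inj₁ refl = edge h
    ... | inj₂ y∈   = step (componentNeighbour⇒fillPath z∈ g) y∈ h

madj⁺⇔componentNeighbour : ∀ {V N} (_≟_ : DecidableEquality V) (G : Graph V) →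
                           Symmetric G → Irreflexive _≡_ G →
                           (α : Fin N → V) → Injective _≡_ _≡_ α → ∀ i w →
                           madj⁺ G α i w ⇔ ((∃ λ z → inComp G α i z × G z w) × ¬ prefix α i w)
madj⁺⇔componentNeighbour _≟_ G s irr α inj i w = mk⇔ to from
  where
  open Elimination _≟_

  to : madj⁺ G α i w → (∃ λ z → inComp G α i z × G z w) × ¬ prefix α i w
  to adj with eliminate-sound s irr (before α i) adj
  ... | _ , w∉ , αi≢w , p = fillPath⇒componentNeighbour α i G p , w∉prefix
    where w∉prefix : ¬ prefix α i w
          w∉prefix pw with prefix⇒current⊎before α i pw
          ... | inj₁ w≡αi = αi≢w (sym w≡αi)
          ... | inj₂ w∈   = w∉ w∈

  from : (∃ λ z → inComp G α i z × G z w) × ¬ prefix α i w → madj⁺ G α i w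
  from ((z , z∈ , h) , w∉prefix) =
    eliminate-complete s irr (before α i) (current∉before α i inj)
      (w∉prefix ∘ before⇒prefix α i) (λ αi≡w → w∉prefix (i , ≤-refl , αi≡w))
      (componentNeighbour⇒fillPath α i G z∈ h)

Rook-sym : ∀ {m n} → Symmetric (Rook m n)
Rook-sym (inj₁ (r≡r′ , c≢c′)) = inj₁ (sym r≡r′ , c≢c′ ∘ sym)
Rook-sym (inj₂ (r≢r′ , c≡c′)) = inj₂ (r≢r′ ∘ sym , sym c≡c′)

Rook-irrefl : ∀ {m n} → Irreflexive _≡_ (Rook m n)
Rook-irrefl refl (inj₁ (_ , c≢c)) = c≢c refl
Rook-irrefl refl (inj₂ (r≢r , _)) = r≢r refl

Rook⇒sameCol⊎sameRow : ∀ {m n} {z w : Vertex m n} → Rook m n z w → col z ≡ col w ⊎ row z ≡ row w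
Rook⇒sameCol⊎sameRow (inj₁ (r≡r′ , _)) = inj₂ r≡r′
Rook⇒sameCol⊎sameRow (inj₂ (_ , c≡c′)) = inj₁ c≡c′

sameCol⇒Rook : ∀ {m n} {z w : Vertex m n} → col z ≡ col w → z ≢ w → Rook m n z w
sameCol⇒Rook {z = r , c} {r′ , c} refl z≢w = inj₂ ((λ { refl → z≢w refl }) , refl)

sameRow⇒Rook : ∀ {m n} {z w : Vertex m n} → row z ≡ row w → z ≢ w → Rook m n z w
sameRow⇒Rook {z = r , c} {r , c′} refl z≢w = inj₁ (refl , (λ { refl → z≢w refl }))

rookComponentNeighbour⇔line : ∀ {m n N} (α : Fin N → Vertex m n) i w → ¬ prefix α i w →
                              (∃ λ z → inComp (Rook m n) α i z × Rook m n z w)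
                              ⇔ (𝓛 α i (col w) ⊎ 𝓜 α i (row w))
rookComponentNeighbour⇔line {m} {n} α i w@(r′ , c′) w∉prefix = mk⇔ to from
  where
  z≢w : ∀ {z} → inComp (Rook m n) α i z → z ≢ w
  z≢w z∈ refl = w∉prefix (inComp⇒prefix α i (Rook m n) z∈)

  to : (∃ λ z → inComp (Rook m n) α i z × Rook m n z w) → 𝓛 α i c′ ⊎ 𝓜 α i r′
  to ((r , c) , z∈ , h) with Rook⇒sameCol⊎sameRow h
  ... | inj₁ refl = inj₁ (r , z∈)
  ... | inj₂ refl = inj₂ (c , z∈)

  from : 𝓛 α i c′ ⊎ 𝓜 α i r′ → ∃ λ z → inComp (Rook m n) α i z × Rook m n z w
  from (inj₁ (r , z∈)) = (r , c′) , z∈ , sameCol⇒Rook refl (z≢w z∈)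
  from (inj₂ (c , z∈)) = (r′ , c) , z∈ , sameRow⇒Rook refl (z≢w z∈)

mainTheorem2 : (m n : ℕ) → m ≥ 2 → n ≥ 2
    → (α : Fin (m * n) → Vertex m n) → Bijective _≡_ _≡_ α
    → (i : Fin (m * n)) (w : Vertex m n)
    → madj⁺ (Rook m n) α i w
    ⇔ (((𝓛 α i (col w)) ⊎ (𝓜 α i (row w))) × ¬ prefix α i w)
mainTheorem2 m n _ _ α bij i w = mk⇔
  (λ adj → let (nb , w∉) = to madj⁺⇔ adj in to (line w∉) nb , w∉)
  (λ (sp , w∉) → from madj⁺⇔ (from (line w∉) sp , w∉))
  where
  open Equivalence
  madj⁺⇔ = madj⁺⇔componentNeighbour (≡-dec Fin._≟_ Fin._≟_) (Rook m n)
             Rook-sym Rook-irrefl α (proj₁ bij) i w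
  line = rookComponentNeighbour⇔line α i w
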